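{- Let $G$ be a unicyclic graph that is not bipartite. If $M$ is a perfect matching of $G$, then $M$ is the unique perfect matching of $G$ and $G$ is a K\"{o}nig-Egerv\'{a}ry graph.
   Context: A graph is unicyclic if it is connected and contains exactly one cycle. For a graph $G$, $\alpha(G)$ is the maximum size of an independent set and $\mu(G)$ is the maximum size of a matching. $G$ is a K\"{o}nig-Egerv\'{a}ry graph if $\alpha(G)+\mu(G)=|V(G)|$. A perfect matching is a matching saturating every vertex. -}

module Defs where

open import Data.Nat using (ℕ; zero; suc; _+_; _≤_; _<_)
open import Data.Bool using (Bool; true; false; if_then_else_)
open import Data.Fin using (Fin; toℕ)
open import Data.Fin.Subset using (Subset; _∈_; ∣_∣)
open import Data.List using (List; []; _∷_; length; map; allFin)
open import Data.Nat.ListAction using (sum)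
open import Data.List.Relation.Unary.Unique.Propositional using (Unique)
open import Data.Product using (Σ; ∃; _×_; _,_)
open import Data.Sum using (_⊎_)
open import Relation.Nullary using (¬_)
open import Relation.Binary.PropositionalEquality using (_≡_; _≢_)
open import Function.Bundles using (_⇔_)

record Graph (n : ℕ) : Set where
  field
    adj     : Fin n → Fin n → Bool
    sym     : ∀ u v → adj u v ≡ adj v u
    irrefl  : ∀ u → adj u u ≡ false
open Graph public

Adj : ∀ {n} → Graph n → Fin n → Fin n → Set
Adj G u v = adj G u v ≡ true

data Walk {n} (G : Graph n) : Fin n → Fin n → Set where
  here : ∀ {u} → Walk G u u
  step : ∀ {u v w} → Adj G u v → Walk G v w → Walk G u w

Connected : ∀ {n} → Graph n → Set
Connected G = ∀ u v → Walk G u v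

Path : ∀ {n} → Graph n → List (Fin n) → Set
Path G []           = Data.Unit.⊤ where import Data.Unit
Path G (x ∷ [])     = Data.Unit.⊤ where import Data.Unit
Path G (x ∷ y ∷ xs) = Adj G x y × Path G (y ∷ xs)

last : ∀ {n} → Fin n → List (Fin n) → Fin n
last x []       = x
last x (y ∷ ys) = last y ys

record Cycle {n} (G : Graph n) : Set where
  field
    start   : Fin n
    rest    : List (Fin n)
    long    : 3 ≤ suc (length rest)
    distinct : Unique (start ∷ rest)
    path    : Path G (start ∷ rest)
    closing : Adj G (last start rest) start
open Cycle public

ConsecIn : ∀ {n} → List (Fin n) → Fin n → Fin n → Set
ConsecIn []           a b = Data.Empty.⊥ where import Data.Empty
ConsecIn (x ∷ [])     a b = Data.Empty.⊥ where import Data.Empty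
ConsecIn (x ∷ y ∷ xs) a b = (x ≡ a × y ≡ b) ⊎ ConsecIn (y ∷ xs) a b

CycleEdge : ∀ {n} {G : Graph n} → Cycle G → Fin n → Fin n → Set
CycleEdge C a b =
    ConsecIn (start C ∷ rest C) a b
  ⊎ ConsecIn (start C ∷ rest C) b a
  ⊎ (last (start C) (rest C) ≡ a × start C ≡ b)
  ⊎ (last (start C) (rest C) ≡ b × start C ≡ a)

SameCycle : ∀ {n} {G : Graph n} → Cycle G → Cycle G → Set
SameCycle C D = ∀ a b → CycleEdge C a b ⇔ CycleEdge D a b

Unicyclic : ∀ {n} → Graph n → Set
Unicyclic G = Connected G × Σ (Cycle G) (λ C → ∀ (D : Cycle G) → SameCycle C D)

Bipartite : ∀ {n} → Graph n → Set
Bipartite {n} G = Σ (Fin n → Bool) λ c → ∀ u v → Adj G u v → c u ≢ c v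

Independent : ∀ {n} → Graph n → Subset n → Set
Independent G S = ∀ u v → u ∈ S → v ∈ S → ¬ Adj G u v

record Matching {n} (G : Graph n) : Set where
  field
    edge     : Fin n → Fin n → Bool
    edge-sym : ∀ u v → edge u v ≡ edge v u
    edge-adj : ∀ u v → edge u v ≡ true → Adj G u v
    disjoint : ∀ u v w → edge u v ≡ true → edge u w ≡ true → v ≡ w
open Matching public

size : ∀ {n} {G : Graph n} → Matching G → ℕ
size {n} M = sum (map (λ u → sum (map (λ v → cnt u v) (allFin n))) (allFin n))
  where
    cnt : Fin n → Fin n → ℕ
    cnt u v with toℕ u Data.Nat.<ᵇ toℕ v | edge M u v
    ... | true | true = 1
    ... | _    | _    = 0

Perfect : ∀ {n} {G : Graph n} → Matching G → Set
Perfect {n} M = ∀ u → ∃ λ v → edge M u v ≡ true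

IsAlpha : ∀ {n} → Graph n → ℕ → Set
IsAlpha {n} G k =
  (Σ (Subset n) λ S → Independent G S × ∣ S ∣ ≡ k)
  × (∀ S → Independent G S → ∣ S ∣ ≤ k)

IsMu : ∀ {n} → Graph n → ℕ → Set
IsMu G k = (Σ (Matching G) λ M → size M ≡ k) × (∀ (M : Matching G) → size M ≤ k)

KonigEgervary : ∀ {n} → Graph n → Set
KonigEgervary {n} G = Σ ℕ λ a → Σ ℕ λ m → IsAlpha G a × IsMu G m × a + m ≡ n

-- Let xy be an edge of the cycle outside M and T = G − xy. T is connected and acyclic, so the
-- parity of walks from x properly 2-colours T. M lies in T, hence matches the two colour
-- classes onto each other; the class avoiding x is independent in G as well (the extra edge
-- xy meets x), and has n/2 = |M| vertices, which gives α = μ = n/2. As G is not bipartite,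
-- x and y get the same colour, so a perfect matching through xy would map that class into
-- its complement minus x, which is too small. Thus every perfect matching lies in T, and two
-- different ones would yield an endless alternating non-backtracking walk, i.e. a cycle in T.

module Submission where

open import Defs renaming (sym to adj-sym)
open import Data.Bool using (Bool; true; false; not; _∧_; _xor_)
open import Data.Bool.Properties using (∧-zeroʳ; ∧-identityʳ; not-distribˡ-xor; not-distribʳ-xor; xor-same; ¬-not; not-¬)
open import Data.Empty using (⊥-elim)
open import Data.Fin using (Fin; zero; suc; toℕ; punchIn; _≟_)
open import Data.Fin.Permutation using (permutation)
open import Data.Fin.Properties using (any?; punchInᵢ≢i; toℕ-injective; pigeonhole)
open import Data.Fin.Subset using (Subset; ∣_∣; _∈_)
open import Data.List as List using (List; []; _∷_; _++_; [_]; length; map; allFin)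
import Data.List.Membership.DecPropositional as Membership
open import Data.List.Membership.Propositional using () renaming (_∈_ to _∈ˡ_)
open import Data.List.Membership.Propositional.Properties using (∈-∃++)
open import Data.List.Properties using (map-tabulate; length-++; ++-assoc)
open import Data.List.Relation.Unary.All as All using (All; []; _∷_)
open import Data.List.Relation.Unary.AllPairs using ([]; _∷_)
open import Data.List.Relation.Unary.Any using (here; there)
open import Data.List.Relation.Unary.Unique.Propositional using (Unique)
open import Data.Nat using (ℕ; zero; suc; _+_; _*_; _∸_; _≤_; _<_; _<ᵇ_; z≤n; s≤s)
open import Data.Nat.ListAction using (sum)
open import Data.Nat.Properties hiding (_≟_)
open import Data.Nat.Tactic.RingSolver using (solve-∀)
open import Data.Product using (Σ; ∃₂; _×_; _,_; proj₁; proj₂)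
open import Data.Sum using (_⊎_; inj₁; inj₂)
import Data.Sum
open import Data.Unit using (⊤; tt)
open import Data.Vec using ([]; _∷_; lookup; tabulate)
open import Data.Vec.Properties using (lookup⇒[]=; []=⇒lookup; lookup∘tabulate)
open import Function using (_∘_; case_of_)
open import Function.Bundles using (mk⇔; Equivalence)
open import Relation.Binary.Definitions using (DecidableEquality)
open import Relation.Binary.PropositionalEquality hiding ([_])
open import Relation.Nullary using (¬_; Dec; yes; no; does; _×-dec_; _⊎-dec_)
open import Relation.Nullary.Decidable using (does-⇔; dec-true; dec-false)

open import Algebra.Properties.CommutativeMonoid.Sum +-0-commutativeMonoid
  using (sum-syntax; sum-permute; sum-remove; sum-cong-≗; ∑-distrib-+; sum-replicate-zero)

-- Counting over Fin n

indicator : Bool → ℕ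
indicator true  = 1
indicator false = 0

count : ∀ {n} → (Fin n → Bool) → ℕ
count {n} P = ∑[ u < n ] indicator (P u)

∑-mono-≤ : ∀ {n} {f g : Fin n → ℕ} → (∀ i → f i ≤ g i) → ∑[ i < n ] f i ≤ ∑[ i < n ] g i
∑-mono-≤ {zero}  f≤g = z≤n
∑-mono-≤ {suc n} f≤g = +-mono-≤ (f≤g zero) (∑-mono-≤ (f≤g ∘ suc))

∑-mono-< : ∀ {n} {f g : Fin n → ℕ} (w : Fin n) →
           (∀ i → f i ≤ g i) → f w < g w → ∑[ i < n ] f i < ∑[ i < n ] g i
∑-mono-< {suc n} {f} {g} w f≤g fw<gw = begin-strict
  ∑[ i < suc n ] f i                    ≡⟨ sum-remove f ⟩
  f w + ∑[ i < n ] f (punchIn w i)      <⟨ +-mono-<-≤ fw<gw (∑-mono-≤ (f≤g ∘ punchIn w)) ⟩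
  g w + ∑[ i < n ] g (punchIn w i)      ≡⟨ sum-remove g ⟨
  ∑[ i < suc n ] g i                    ∎
  where open ≤-Reasoning

∑-const-1 : ∀ n → ∑[ i < n ] 1 ≡ n
∑-const-1 zero    = refl
∑-const-1 (suc n) = cong suc (∑-const-1 n)

∑-single : ∀ {n} (f : Fin n → ℕ) (w : Fin n) → (∀ i → i ≢ w → f i ≡ 0) → ∑[ i < n ] f i ≡ f w
∑-single {suc n} f w vanish = begin
  ∑[ i < suc n ] f i                ≡⟨ sum-remove f ⟩
  f w + ∑[ i < n ] f (punchIn w i)  ≡⟨ cong (f w +_) (trans (sum-cong-≗ (λ i → vanish _ (punchInᵢ≢i w i))) (sum-replicate-zero n)) ⟩
  f w + 0                           ≡⟨ +-identityʳ (f w) ⟩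
  f w                               ∎
  where open ≡-Reasoning

sum-tabulate : ∀ {n} (f : Fin n → ℕ) → sum (List.tabulate f) ≡ ∑[ i < n ] f i
sum-tabulate {zero}  f = refl
sum-tabulate {suc n} f = cong (f zero +_) (sum-tabulate (f ∘ suc))

sum-map-allFin : ∀ {n} (f : Fin n → ℕ) → sum (map f (allFin n)) ≡ ∑[ i < n ] f i
sum-map-allFin f = trans (cong sum (map-tabulate (λ i → i) f)) (sum-tabulate f)

∣p∣≡count : ∀ {n} (p : Subset n) → ∣ p ∣ ≡ count (lookup p)
∣p∣≡count []          = refl
∣p∣≡count (true ∷ p)  = cong suc (∣p∣≡count p)
∣p∣≡count (false ∷ p) = ∣p∣≡count p

indicator-+-≤-1 : ∀ a b → (a ≡ true → b ≡ false) → indicator a + indicator b ≤ 1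
indicator-+-≤-1 true  true  a⇒¬b = case a⇒¬b refl of λ ()
indicator-+-≤-1 true  false _    = s≤s z≤n
indicator-+-≤-1 false true  _    = s≤s z≤n
indicator-+-≤-1 false false _    = z≤n

indicator-+-not : ∀ b → indicator b + indicator (not b) ≡ 1
indicator-+-not true  = refl
indicator-+-not false = refl

module _ {n} (π : Fin n → Fin n) (π-involutive : ∀ u → π (π u) ≡ u) (P : Fin n → Bool) where

  private
    2*count : 2 * count P ≡ ∑[ u < n ] (indicator (P u) + indicator (P (π u)))
    2*count = begin
      2 * count P                                          ≡⟨ cong (count P +_) (+-identityʳ (count P)) ⟩
      count P + count P                                    ≡⟨ cong (count P +_) (sum-permute _ (permutation π π π-involutive π-involutive)) ⟩
      count P + ∑[ u < n ] indicator (P (π u))             ≡⟨ ∑-distrib-+ (indicator ∘ P) (indicator ∘ P ∘ π) ⟨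
      ∑[ u < n ] (indicator (P u) + indicator (P (π u)))   ∎
      where open ≡-Reasoning

  2*count≤n : (∀ u → P u ≡ true → P (π u) ≡ false) → 2 * count P ≤ n
  2*count≤n leaves = begin
    2 * count P                                         ≡⟨ 2*count ⟩
    ∑[ u < n ] (indicator (P u) + indicator (P (π u)))  ≤⟨ ∑-mono-≤ (λ u → indicator-+-≤-1 (P u) (P (π u)) (leaves u)) ⟩
    ∑[ u < n ] 1                                        ≡⟨ ∑-const-1 n ⟩
    n                                                   ∎
    where open ≤-Reasoning

  2*count<n : (∀ u → P u ≡ true → P (π u) ≡ false) → ∀ x → P x ≡ false → P (π x) ≡ false → 2 * count P < n
  2*count<n leaves x Px Pπx = begin-strict
    2 * count P                                         ≡⟨ 2*count ⟩
    ∑[ u < n ] (indicator (P u) + indicator (P (π u)))  <⟨ ∑-mono-< x (λ u → indicator-+-≤-1 (P u) (P (π u)) (leaves u)) zero-at-x ⟩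
    ∑[ u < n ] 1                                        ≡⟨ ∑-const-1 n ⟩
    n                                                   ∎
    where
    open ≤-Reasoning
    zero-at-x : indicator (P x) + indicator (P (π x)) < 1
    zero-at-x rewrite Px | Pπx = s≤s z≤n

  2*count≡n : (∀ u → P (π u) ≡ not (P u)) → 2 * count P ≡ n
  2*count≡n swaps = begin
    2 * count P                                          ≡⟨ 2*count ⟩
    ∑[ u < n ] (indicator (P u) + indicator (P (π u)))   ≡⟨ sum-cong-≗ (λ u → cong (λ b → indicator (P u) + indicator b) (swaps u)) ⟩
    ∑[ u < n ] (indicator (P u) + indicator (not (P u))) ≡⟨ sum-cong-≗ (indicator-+-not ∘ P) ⟩
    ∑[ u < n ] 1                                         ≡⟨ ∑-const-1 n ⟩
    n                                                    ∎
    where open ≡-Reasoning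

-- Matchings

<ᵇ-irrefl : ∀ m → (m <ᵇ m) ≡ false
<ᵇ-irrefl zero    = refl
<ᵇ-irrefl (suc m) = <ᵇ-irrefl m

<ᵇ-asym : ∀ m n → (m <ᵇ n) ≡ true → (n <ᵇ m) ≡ false
<ᵇ-asym zero    (suc n) _ = refl
<ᵇ-asym (suc m) (suc n) m<n = <ᵇ-asym m n m<n

<ᵇ-flip : ∀ m n → m ≢ n → (n <ᵇ m) ≡ not (m <ᵇ n)
<ᵇ-flip zero    zero    m≢n = ⊥-elim (m≢n refl)
<ᵇ-flip zero    (suc n) _   = refl
<ᵇ-flip (suc m) zero    _   = refl
<ᵇ-flip (suc m) (suc n) m≢n = <ᵇ-flip m n (m≢n ∘ cong suc)

Adj⇒≢ : ∀ {n} (G : Graph n) {u v} → Adj G u v → u ≢ v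
Adj⇒≢ G {u} uu refl with () ← trans (sym (irrefl G u)) uu

module _ {n} {G : Graph n} (M : Matching G) where

  partner : Fin n → Fin n
  partner u with any? (λ v → edge M u v Data.Bool.≟ true)
  ... | yes (v , _) = v
  ... | no _        = u

  partner-spec : ∀ u → edge M u (partner u) ≡ true ⊎ (partner u ≡ u × ∀ v → edge M u v ≢ true)
  partner-spec u with any? (λ v → edge M u v Data.Bool.≟ true)
  ... | yes (_ , uv) = inj₁ uv
  ... | no ¬uv       = inj₂ (refl , λ v uv → ¬uv (v , uv))

  partner-matched : ∀ {u v} → edge M u v ≡ true → partner u ≡ v
  partner-matched {u} {v} uv with partner-spec u
  ... | inj₁ upu         = disjoint M u (partner u) v upu uv
  ... | inj₂ (_ , ¬edge) = ⊥-elim (¬edge v uv)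

  partner-involutive : ∀ u → partner (partner u) ≡ u
  partner-involutive u with partner-spec u
  ... | inj₁ upu          = partner-matched (trans (edge-sym M (partner u) u) upu)
  ... | inj₂ (pu≡u , _)   = trans (cong partner pu≡u) pu≡u

  edge-partner : Perfect M → ∀ u → edge M u (partner u) ≡ true
  edge-partner perfect u with v , uv ← perfect u = subst (λ w → edge M u w ≡ true) (sym (partner-matched uv)) uv

  partner⇒edge : Perfect M → ∀ {u v} → partner u ≡ v → edge M u v ≡ true
  partner⇒edge perfect {u} refl = edge-partner perfect u

  lower : Fin n → Bool
  lower u = toℕ u <ᵇ toℕ (partner u)

  -- size sums a function local to Defs that cannot be named: unification recovers it as
  -- proj₁ summand, and with-abstraction over its Boolean arguments then evaluates it.
  private
    summand : Σ (Fin n → Fin n → ℕ) λ h → size M ≡ sum (map (λ u → sum (map (h u) (allFin n))) (allFin n))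
    summand = _ , refl

    summand-≡ : ∀ u v → proj₁ summand u v ≡ indicator ((toℕ u <ᵇ toℕ v) ∧ edge M u v)
    summand-≡ u v with toℕ u <ᵇ toℕ v | edge M u v
    ... | true  | true  = refl
    ... | true  | false = refl
    ... | false | _     = refl

    row-sum : ∀ u → ∑[ v < n ] indicator ((toℕ u <ᵇ toℕ v) ∧ edge M u v) ≡ indicator (lower u)
    row-sum u = trans (∑-single _ (partner u) off-partner) (cong indicator at-partner)
      where
      off-partner : ∀ v → v ≢ partner u → indicator ((toℕ u <ᵇ toℕ v) ∧ edge M u v) ≡ 0
      off-partner v v≢pu with edge M u v in uv
      ... | true  = ⊥-elim (v≢pu (sym (partner-matched uv)))
      ... | false = cong indicator (∧-zeroʳ _)
      at-partner : (lower u ∧ edge M u (partner u)) ≡ lower u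
      at-partner with partner-spec u
      ... | inj₁ upu        = trans (cong (lower u ∧_) upu) (∧-identityʳ _)
      ... | inj₂ (pu≡u , _) = trans (cong (_∧ edge M u (partner u)) lu≡false) (sym lu≡false)
        where
        lu≡false : lower u ≡ false
        lu≡false = trans (cong (λ w → toℕ u <ᵇ toℕ w) pu≡u) (<ᵇ-irrefl (toℕ u))

  size≡count-lower : size M ≡ count lower
  size≡count-lower = begin
    size M                                                   ≡⟨ proj₂ summand ⟩
    sum (map (λ u → sum (map (h u) (allFin n))) (allFin n))  ≡⟨ sum-map-allFin (λ u → sum (map (h u) (allFin n))) ⟩
    ∑[ u < n ] sum (map (h u) (allFin n))                    ≡⟨ sum-cong-≗ (λ u → sum-map-allFin (h u)) ⟩
    ∑[ u < n ] ∑[ v < n ] h u v                              ≡⟨ sum-cong-≗ (λ u → trans (sum-cong-≗ (summand-≡ u)) (row-sum u)) ⟩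
    count lower                                              ∎
    where
    open ≡-Reasoning
    h : Fin n → Fin n → ℕ
    h = proj₁ summand

  lower-partner : ∀ u → lower (partner u) ≡ (toℕ (partner u) <ᵇ toℕ u)
  lower-partner u = cong (λ w → toℕ (partner u) <ᵇ toℕ w) (partner-involutive u)

  2*size≤n : 2 * size M ≤ n
  2*size≤n = subst (λ s → 2 * s ≤ n) (sym size≡count-lower)
    (2*count≤n partner partner-involutive lower (λ u lu → trans (lower-partner u) (<ᵇ-asym (toℕ u) (toℕ (partner u)) lu)))

  2*size≡n : Perfect M → 2 * size M ≡ n
  2*size≡n perfect = trans (cong (2 *_) size≡count-lower) (2*count≡n partner partner-involutive lower swaps)
    where
    swaps : ∀ u → lower (partner u) ≡ not (lower u)
    swaps u = trans (lower-partner u) (<ᵇ-flip (toℕ u) (toℕ (partner u)) (Adj⇒≢ G (edge-adj M _ _ (edge-partner perfect u)) ∘ toℕ-injective))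

-- Lists

data HasRepeat {A : Set} : List A → Set where
  repeat : ∀ as z bs cs → HasRepeat (as ++ z ∷ bs ++ z ∷ cs)

unique-or-repeat : ∀ {A : Set} → DecidableEquality A → (xs : List A) → Unique xs ⊎ HasRepeat xs
unique-or-repeat _≟_ [] = inj₁ []
unique-or-repeat _≟_ (x ∷ xs) with Membership._∈?_ _≟_ x xs
... | yes x∈xs with bs , cs , refl ← ∈-∃++ x∈xs = inj₂ (repeat [] x bs cs)
... | no x∉xs with unique-or-repeat _≟_ xs
...   | inj₁ unique              = inj₁ (All.tabulate (λ { y∈xs refl → x∉xs y∈xs }) ∷ unique)
...   | inj₂ (repeat as z bs cs) = inj₂ (repeat (x ∷ as) z bs cs)

length-repeat : ∀ {A : Set} (as : List A) z bs cs →
                length (as ++ z ∷ bs ++ z ∷ cs) ≡ length (bs ++ [ z ]) + length (as ++ z ∷ cs)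
length-repeat as z bs cs
  rewrite length-++ as {z ∷ bs ++ z ∷ cs} | length-++ bs {z ∷ cs} | length-++ bs {[ z ]} | length-++ as {z ∷ cs}
  = shuffle (length as) (length bs) (length cs)
  where
  shuffle : ∀ a b c → a + suc (b + suc c) ≡ b + 1 + (a + suc c)
  shuffle = solve-∀

0<length-++-∷ : ∀ {A : Set} (xs : List A) y ys → 0 < length (xs ++ y ∷ ys)
0<length-++-∷ []       y ys = s≤s z≤n
0<length-++-∷ (x ∷ xs) y ys = s≤s z≤n

length-loop< : ∀ {A : Set} (as : List A) z bs cs → length (bs ++ [ z ]) < length (as ++ z ∷ bs ++ z ∷ cs)
length-loop< as z bs cs = <-≤-trans (m<m+n _ (0<length-++-∷ as z cs)) (≤-reflexive (sym (length-repeat as z bs cs)))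

length-rest< : ∀ {A : Set} (as : List A) z bs cs → length (as ++ z ∷ cs) < length (as ++ z ∷ bs ++ z ∷ cs)
length-rest< as z bs cs = <-≤-trans (m<n+m _ (0<length-++-∷ bs z [])) (≤-reflexive (sym (length-repeat as z bs cs)))

last-++ : ∀ {n} (x : Fin n) ys z zs → last x (ys ++ z ∷ zs) ≡ last z zs
last-++ x []       z zs = refl
last-++ x (y ∷ ys) z zs = last-++ y ys z zs

last-rest : ∀ {n} (a : Fin n) as z bs cs → last a (as ++ z ∷ cs) ≡ last a (as ++ z ∷ bs ++ z ∷ cs)
last-rest a as z bs cs = begin
  last a (as ++ z ∷ cs)           ≡⟨ last-++ a as z cs ⟩
  last z cs                       ≡⟨ last-++ z bs z cs ⟨
  last z (bs ++ z ∷ cs)           ≡⟨ last-++ a as z (bs ++ z ∷ cs) ⟨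
  last a (as ++ z ∷ bs ++ z ∷ cs) ∎
  where open ≡-Reasoning

last∈ : ∀ {n} (x : Fin n) ys → last x ys ∈ˡ x ∷ ys
last∈ x []       = here refl
last∈ x (y ∷ ys) = there (last∈ y ys)

NonBacktracking : ∀ {A : Set} → List A → Set
NonBacktracking (x ∷ y ∷ z ∷ r) = x ≢ z × NonBacktracking (y ∷ z ∷ r)
NonBacktracking _               = ⊤

nonBacktracking-tail : ∀ {A : Set} (x : A) l → NonBacktracking (x ∷ l) → NonBacktracking l
nonBacktracking-tail x []          _       = tt
nonBacktracking-tail x (y ∷ [])    _       = tt
nonBacktracking-tail x (y ∷ z ∷ r) (_ , p) = p

nonBacktracking-++ʳ : ∀ {A : Set} (xs ys : List A) → NonBacktracking (xs ++ ys) → NonBacktracking ys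
nonBacktracking-++ʳ []       ys p = p
nonBacktracking-++ʳ (x ∷ xs) ys p = nonBacktracking-++ʳ xs ys (nonBacktracking-tail x (xs ++ ys) p)

nonBacktracking-++ˡ : ∀ {A : Set} (xs ys : List A) → NonBacktracking (xs ++ ys) → NonBacktracking xs
nonBacktracking-++ˡ []               ys _        = tt
nonBacktracking-++ˡ (x ∷ [])         ys _        = tt
nonBacktracking-++ˡ (x ∷ y ∷ [])     ys _        = tt
nonBacktracking-++ˡ (x ∷ y ∷ z ∷ xs) ys (x≢z , p) = x≢z , nonBacktracking-++ˡ (y ∷ z ∷ xs) ys p

-- Walks and cycles

odd : ℕ → Bool
odd zero    = false
odd (suc n) = not (odd n)

odd-+ : ∀ m n → odd (m + n) ≡ odd m xor odd n
odd-+ zero    n = refl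
odd-+ (suc m) n = trans (cong not (odd-+ m n)) (not-distribˡ-xor (odd m) (odd n))

module Walks {n} (G : Graph n) where

  lengthʷ : ∀ {u v} → Walk G u v → ℕ
  lengthʷ here       = 0
  lengthʷ (step _ w) = suc (lengthʷ w)

  _++ʷ_ : ∀ {u v w} → Walk G u v → Walk G v w → Walk G u w
  here     ++ʷ q = q
  step e p ++ʷ q = step e (p ++ʷ q)

  length-++ʷ : ∀ {u v w} (p : Walk G u v) (q : Walk G v w) → lengthʷ (p ++ʷ q) ≡ lengthʷ p + lengthʷ q
  length-++ʷ here       q = refl
  length-++ʷ (step e p) q = cong suc (length-++ʷ p q)

  reverseʷ : ∀ {u v} → Walk G u v → Walk G v u
  reverseʷ here                 = here
  reverseʷ (step {u} {v} e p) = reverseʷ p ++ʷ step (trans (adj-sym G v u) e) here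

  length-reverseʷ : ∀ {u v} (p : Walk G u v) → lengthʷ (reverseʷ p) ≡ lengthʷ p
  length-reverseʷ here       = refl
  length-reverseʷ (step e p) = trans (length-++ʷ (reverseʷ p) _) (trans (+-comm _ 1) (cong suc (length-reverseʷ p)))

  vertices : ∀ {u v} → Walk G u v → List (Fin n)
  vertices here                 = []
  vertices (step {v = v} _ w) = v ∷ vertices w

  path-vertices : ∀ {u v} (w : Walk G u v) → Path G (u ∷ vertices w)
  path-vertices here                = tt
  path-vertices (step e here)       = e , tt
  path-vertices (step e (step f w)) = e , path-vertices (step f w)

  last-vertices : ∀ {u v} (w : Walk G u v) → last u (vertices w) ≡ v
  last-vertices here       = refl
  last-vertices (step _ w) = last-vertices w

  length-vertices : ∀ {u v} (w : Walk G u v) → length (vertices w) ≡ lengthʷ w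
  length-vertices here       = refl
  length-vertices (step _ w) = cong suc (length-vertices w)

  path-++ˡ : ∀ xs ys → Path G (xs ++ ys) → Path G xs
  path-++ˡ []           ys p       = tt
  path-++ˡ (x ∷ [])     ys p       = tt
  path-++ˡ (x ∷ y ∷ xs) ys (e , p) = e , path-++ˡ (y ∷ xs) ys p

  path-++ʳ : ∀ xs ys → Path G (xs ++ ys) → Path G ys
  path-++ʳ []           ys       p       = p
  path-++ʳ (x ∷ [])     []       p       = tt
  path-++ʳ (x ∷ [])     (y ∷ ys) (e , p) = p
  path-++ʳ (x ∷ y ∷ xs) ys       (e , p) = path-++ʳ (y ∷ xs) ys p

  path-++ : ∀ xs z ys → Path G (xs ++ [ z ]) → Path G (z ∷ ys) → Path G (xs ++ z ∷ ys)
  path-++ []           z ys p       q = q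
  path-++ (x ∷ [])     z ys (e , _) q = e , q
  path-++ (x ∷ y ∷ xs) z ys (e , p) q = e , path-++ (y ∷ xs) z ys p q

  path-loop : ∀ a as z bs cs → Path G (a ∷ as ++ z ∷ bs ++ z ∷ cs) → Path G (z ∷ bs ++ [ z ])
  path-loop a as z bs cs p = path-++ˡ (z ∷ bs ++ [ z ]) cs
    (subst (Path G) (cong (z ∷_) (sym (++-assoc bs [ z ] cs))) (path-++ʳ (a ∷ as) (z ∷ bs ++ z ∷ cs) p))

  path-rest : ∀ a as z bs cs → Path G (a ∷ as ++ z ∷ bs ++ z ∷ cs) → Path G (a ∷ as ++ z ∷ cs)
  path-rest a as z bs cs p = path-++ (a ∷ as) z cs
    (path-++ˡ (a ∷ as ++ [ z ]) (bs ++ z ∷ cs) (subst (Path G) (cong (a ∷_) (sym (++-assoc as [ z ] (bs ++ z ∷ cs)))) p))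
    (path-++ʳ (a ∷ as ++ z ∷ bs) (z ∷ cs) (subst (Path G) (cong (a ∷_) (sym (++-assoc as (z ∷ bs) (z ∷ cs)))) p))

  -- Cutting a closed walk a L at a repeated vertex z leaves the loop z bs z and the shorter
  -- closed walk a as z cs; Good must pass to one of them.
  module _ (Good : Fin n → List (Fin n) → Set)
           (good-split : ∀ a as z bs cs → Good a (as ++ z ∷ bs ++ z ∷ cs) →
                         Good z (bs ++ [ z ]) ⊎ Good a (as ++ z ∷ cs))
           (good-long : ∀ a L → Path G (a ∷ L) → last a L ≡ a → Good a L → 3 ≤ length L) where

    private
      unique⇒cycle : ∀ a L → Path G (a ∷ L) → last a L ≡ a → Good a L → Unique L → Cycle G
      unique⇒cycle a []      p       closed good _ with () ← good-long a [] p closed good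
      unique⇒cycle a (b ∷ R) (e , p) closed good unique = record
        { start    = b
        ; rest     = R
        ; long     = good-long a (b ∷ R) (e , p) closed good
        ; distinct = unique
        ; path     = p
        ; closing  = subst (λ z → Adj G z b) (sym closed) e
        }

      extract : ∀ fuel a L → length L < fuel → Path G (a ∷ L) → last a L ≡ a → Good a L → Cycle G
      extract (suc fuel) a L L<fuel p closed good with unique-or-repeat _≟_ L
      ... | inj₁ unique = unique⇒cycle a L p closed good unique
      ... | inj₂ (repeat as z bs cs) with good-split a as z bs cs good
      ...   | inj₁ good-loop =
        extract fuel z (bs ++ [ z ]) (<-≤-trans (length-loop< as z bs cs) (≤-pred L<fuel))
          (path-loop a as z bs cs p) (last-++ z bs z []) good-loop
      ...   | inj₂ good-rest =
        extract fuel a (as ++ z ∷ cs) (<-≤-trans (length-rest< as z bs cs) (≤-pred L<fuel))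
          (path-rest a as z bs cs p) (trans (last-rest a as z bs cs) closed) good-rest

    closed-walk⇒cycle : ∀ a L → Path G (a ∷ L) → last a L ≡ a → Good a L → Cycle G
    closed-walk⇒cycle a L = extract (suc (length L)) a L ≤-refl

  private
    no-loop : ∀ {a b} → Adj G a b → b ≢ a
    no-loop e b≡a = Adj⇒≢ G e (sym b≡a)

  odd-closed-walk⇒cycle : ∀ {u} (w : Walk G u u) → odd (lengthʷ w) ≡ true → Cycle G
  odd-closed-walk⇒cycle {u} w odd-w =
    closed-walk⇒cycle OddLength split odd-long u (vertices w) (path-vertices w) (last-vertices w)
      (trans (cong odd (length-vertices w)) odd-w)
    where
    OddLength : Fin n → List (Fin n) → Set
    OddLength _ L = odd (length L) ≡ true

    split : ∀ a as z bs cs → OddLength a (as ++ z ∷ bs ++ z ∷ cs) →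
            OddLength z (bs ++ [ z ]) ⊎ OddLength a (as ++ z ∷ cs)
    split a as z bs cs odd-L with odd (length (bs ++ [ z ])) in odd-loop
    ... | true  = inj₁ refl
    ... | false = inj₂ (begin
      odd (length (as ++ z ∷ cs))                                       ≡⟨⟩
      false xor odd (length (as ++ z ∷ cs))                             ≡⟨ cong (_xor _) odd-loop ⟨
      odd (length (bs ++ [ z ])) xor odd (length (as ++ z ∷ cs))        ≡⟨ odd-+ (length (bs ++ [ z ])) _ ⟨
      odd (length (bs ++ [ z ]) + length (as ++ z ∷ cs))                ≡⟨ cong odd (length-repeat as z bs cs) ⟨
      odd (length (as ++ z ∷ bs ++ z ∷ cs))                             ≡⟨ odd-L ⟩
      true                                                              ∎)
      where open ≡-Reasoning

    odd-long : ∀ a L → Path G (a ∷ L) → last a L ≡ a → OddLength a L → 3 ≤ length L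
    odd-long a (b ∷ [])         (e , _) closed _ = ⊥-elim (no-loop e closed)
    odd-long a (b ∷ c ∷ d ∷ R)  _       _      _ = s≤s (s≤s (s≤s z≤n))

  module _ (s : ℕ → Fin n) (adjacent : ∀ t → Adj G (s t) (s (suc t))) (no-return : ∀ t → s t ≢ s (suc (suc t))) where

    private
      segment : ℕ → ℕ → List (Fin n)
      segment i zero    = []
      segment i (suc k) = s (suc i) ∷ segment (suc i) k

      path-segment : ∀ i k → Path G (s i ∷ segment i k)
      path-segment i zero          = tt
      path-segment i (suc zero)    = adjacent i , tt
      path-segment i (suc (suc k)) = adjacent i , path-segment (suc i) (suc k)

      nonBacktracking-segment : ∀ i k → NonBacktracking (s i ∷ segment i k)
      nonBacktracking-segment i zero          = tt
      nonBacktracking-segment i (suc zero)    = tt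
      nonBacktracking-segment i (suc (suc k)) = no-return i , nonBacktracking-segment (suc i) (suc k)

      last-segment : ∀ i k → last (s i) (segment i k) ≡ s (k + i)
      last-segment i zero    = refl
      last-segment i (suc k) = trans (last-segment (suc i) k) (cong s (+-suc k i))

      length-segment : ∀ i k → length (segment i k) ≡ k
      length-segment i zero    = refl
      length-segment i (suc k) = cong suc (length-segment (suc i) k)

      Loop : Fin n → List (Fin n) → Set
      Loop a L = 0 < length L × NonBacktracking (a ∷ L)

      split : ∀ a as z bs cs → Loop a (as ++ z ∷ bs ++ z ∷ cs) → Loop z (bs ++ [ z ]) ⊎ Loop a (as ++ z ∷ cs)
      split a as z bs cs (_ , nb) = inj₁ (0<length-++-∷ bs z [] ,
        nonBacktracking-++ˡ (z ∷ bs ++ [ z ]) cs (subst NonBacktracking (cong (z ∷_) (sym (++-assoc bs [ z ] cs)))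
          (nonBacktracking-++ʳ (a ∷ as) (z ∷ bs ++ z ∷ cs) nb)))

      loop-long : ∀ a L → Path G (a ∷ L) → last a L ≡ a → Loop a L → 3 ≤ length L
      loop-long a (b ∷ [])        (e , _) closed _            = ⊥-elim (no-loop e closed)
      loop-long a (b ∷ c ∷ [])    _       closed (_ , a≢c , _) = ⊥-elim (a≢c (sym closed))
      loop-long a (b ∷ c ∷ d ∷ R) _       _      _            = s≤s (s≤s (s≤s z≤n))

    nonBacktracking-sequence⇒cycle : Cycle G
    nonBacktracking-sequence⇒cycle with i , j , i<j , si≡sj ← pigeonhole (n<1+n n) (λ (j : Fin (suc n)) → s (toℕ j)) =
      closed-walk⇒cycle Loop split loop-long (s (toℕ i)) (segment (toℕ i) k) (path-segment (toℕ i) k)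
        (trans (last-segment (toℕ i) k) (trans (cong s (m∸n+n≡m (<⇒≤ i<j))) (sym si≡sj)))
        (subst (0 <_) (sym (length-segment (toℕ i) k)) (m<n⇒0<n∸m i<j) , nonBacktracking-segment (toℕ i) k)
      where
      k : ℕ
      k = toℕ j ∸ toℕ i

-- Deleting an edge

_⊆ᴳ_ : ∀ {n} → Graph n → Graph n → Set
H ⊆ᴳ G = ∀ {u v} → Adj H u v → Adj G u v

module _ {n} {H G : Graph n} (H⊆G : H ⊆ᴳ G) where

  path-⊆ : ∀ L → Path H L → Path G L
  path-⊆ []          _       = tt
  path-⊆ (_ ∷ [])    _       = tt
  path-⊆ (_ ∷ b ∷ L) (e , p) = H⊆G e , path-⊆ (b ∷ L) p

  cycle-⊆ : Cycle H → Cycle G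
  cycle-⊆ D = record
    { start = start D ; rest = rest D ; long = long D ; distinct = distinct D
    ; path = path-⊆ _ (path D) ; closing = H⊆G (closing D) }

consecIn-adj : ∀ {n} {G : Graph n} L {a b} → Path G L → ConsecIn L a b → Adj G a b
consecIn-adj (_ ∷ _ ∷ L) (e , _) (inj₁ (refl , refl)) = e
consecIn-adj (_ ∷ v ∷ L) (_ , p) (inj₂ c)             = consecIn-adj (v ∷ L) p c

cycleEdge-adj : ∀ {n} {G : Graph n} (D : Cycle G) {a b} → CycleEdge D a b → Adj G a b
cycleEdge-adj D (inj₁ c)                         = consecIn-adj _ (path D) c
cycleEdge-adj {G = G} D {a} {b} (inj₂ (inj₁ c))  = trans (adj-sym G a b) (consecIn-adj _ (path D) c)
cycleEdge-adj D (inj₂ (inj₂ (inj₁ (refl , refl)))) = closing D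
cycleEdge-adj {G = G} D {a} {b} (inj₂ (inj₂ (inj₂ (refl , refl)))) = trans (adj-sym G a b) (closing D)

module _ {n} (x y : Fin n) where

  IsEdge : Fin n → Fin n → Set
  IsEdge u v = (u ≡ x × v ≡ y) ⊎ (u ≡ y × v ≡ x)

  isEdge? : ∀ u v → Dec (IsEdge u v)
  isEdge? u v = (u ≟ x ×-dec v ≟ y) ⊎-dec (u ≟ y ×-dec v ≟ x)

  IsEdge-sym : ∀ {u v} → IsEdge u v → IsEdge v u
  IsEdge-sym (inj₁ (u≡x , v≡y)) = inj₂ (v≡y , u≡x)
  IsEdge-sym (inj₂ (u≡y , v≡x)) = inj₁ (v≡x , u≡y)

module _ {n} (G : Graph n) (x y : Fin n) where

  deleteEdge : Graph n
  deleteEdge = record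
    { adj    = λ u v → adj G u v ∧ not (does (isEdge? x y u v))
    ; sym    = λ u v → cong₂ (λ a b → a ∧ not b) (adj-sym G u v)
                         (does-⇔ (mk⇔ (IsEdge-sym x y) (IsEdge-sym x y)) (isEdge? x y u v) (isEdge? x y v u))
    ; irrefl = λ u → cong (_∧ _) (irrefl G u)
    }

  deleteEdge-⊆ : deleteEdge ⊆ᴳ G
  deleteEdge-⊆ {u} {v} e with adj G u v
  ... | true = refl

  keep-edge : ∀ {u v} → Adj G u v → ¬ IsEdge x y u v → Adj deleteEdge u v
  keep-edge {u} {v} e ¬xy rewrite e | dec-false (isEdge? x y u v) ¬xy = refl

  deleted-edge : ∀ {u v} → IsEdge x y u v → ¬ Adj deleteEdge u v
  deleted-edge {u} {v} xy e rewrite dec-true (isEdge? x y u v) xy | ∧-zeroʳ (adj G u v) with () ← e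

  deleted-or-kept : ∀ {u v} → Adj G u v → IsEdge x y u v ⊎ Adj deleteEdge u v
  deleted-or-kept {u} {v} e with isEdge? x y u v
  ... | yes xy = inj₁ xy
  ... | no ¬xy = inj₂ (keep-edge e ¬xy)

  avoiding⇒deleteEdge : ∀ (N : Matching G) → edge N x y ≡ false → ∀ {u v} → edge N u v ≡ true → Adj deleteEdge u v
  avoiding⇒deleteEdge N xy∉N {u} {v} uv = keep-edge (edge-adj N u v uv) λ where
    (inj₁ (refl , refl)) → case trans (sym xy∉N) uv of λ ()
    (inj₂ (refl , refl)) → case trans (sym xy∉N) (trans (edge-sym N x y) uv) of λ ()

  restrict : ∀ (N : Matching G) → edge N x y ≡ false → Matching deleteEdge
  restrict N xy∉N = record
    { edge = edge N ; edge-sym = edge-sym N ; edge-adj = λ u v → avoiding⇒deleteEdge N xy∉N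
    ; disjoint = disjoint N }

-- The König–Egerváry property

module _ {n} {G : Graph n} (M : Matching G) (perfect : Perfect M) where

  independent-≤-size : ∀ S → Independent G S → ∣ S ∣ ≤ size M
  independent-≤-size S independent = *-cancelˡ-≤ 2 (begin
    2 * ∣ S ∣            ≡⟨ cong (2 *_) (∣p∣≡count S) ⟩
    2 * count (lookup S) ≤⟨ 2*count≤n (partner M) (partner-involutive M) (lookup S) leaves ⟩
    n                    ≡⟨ 2*size≡n M perfect ⟨
    2 * size M           ∎)
    where
    open ≤-Reasoning
    leaves : ∀ u → lookup S u ≡ true → lookup S (partner M u) ≡ false
    leaves u u∈S with lookup S (partner M u) in pu∈S
    ... | false = refl
    ... | true  = ⊥-elim (independent u (partner M u) (lookup⇒[]= u S u∈S) (lookup⇒[]= (partner M u) S pu∈S)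
                            (edge-adj M u (partner M u) (edge-partner M perfect u)))

  size-≤-size : ∀ (M′ : Matching G) → size M′ ≤ size M
  size-≤-size M′ = *-cancelˡ-≤ 2 (≤-trans (2*size≤n M′) (≤-reflexive (sym (2*size≡n M perfect))))

  konigEgervary : ∀ S → Independent G S → ∣ S ∣ ≡ size M → KonigEgervary G
  konigEgervary S independent ∣S∣≡size =
    size M , size M , ((S , independent , ∣S∣≡size) , independent-≤-size)
                    , ((M , refl) , size-≤-size)
                    , trans (cong (size M +_) (sym (+-identityʳ (size M)))) (2*size≡n M perfect)

-- Perfect matchings of acyclic graphs

module _ {n} {H : Graph n} (acyclic : ¬ Cycle H)
         (M M′ : Matching H) (perfect : Perfect M) (perfect′ : Perfect M′) where

  private
    q q′ : Fin n → Fin n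
    q  = partner M
    q′ = partner M′

    next : Fin n × Bool → Fin n × Bool
    next (v , true)  = q′ v , false
    next (v , false) = q v , true

    Diverge : Fin n → Set
    Diverge v = q′ v ≢ q v

    next-diverge : ∀ p → Diverge (proj₁ p) → Diverge (proj₁ (next p))
    next-diverge (v , true)  d e = d (sym (trans (cong q (trans (sym (partner-involutive M′ v)) e)) (partner-involutive M (q′ v))))
    next-diverge (v , false) d e = d (trans (sym (cong q′ (trans e (partner-involutive M v)))) (partner-involutive M′ (q v)))

    next-adjacent : ∀ p → Adj H (proj₁ p) (proj₁ (next p))
    next-adjacent (v , true)  = edge-adj M′ v (q′ v) (edge-partner M′ perfect′ v)
    next-adjacent (v , false) = edge-adj M  v (q v)  (edge-partner M perfect v)

    next-no-return : ∀ p → Diverge (proj₁ p) → proj₁ p ≢ proj₁ (next (next p))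
    next-no-return (v , true)  d e = d (trans (sym (partner-involutive M (q′ v))) (cong q (sym e)))
    next-no-return (v , false) d e = d (sym (trans (sym (partner-involutive M′ (q v))) (cong q′ (sym e))))

    partners-agree : ∀ a → q′ a ≡ q a
    partners-agree a with q′ a ≟ q a
    ... | yes agree = agree
    ... | no d = ⊥-elim (acyclic (Walks.nonBacktracking-sequence⇒cycle H s (λ t → next-adjacent (walk t))
                                    (λ t → next-no-return (walk t) (diverge t))))
      where
      walk : ℕ → Fin n × Bool
      walk zero    = a , true
      walk (suc t) = next (walk t)
      s : ℕ → Fin n
      s = proj₁ ∘ walk
      diverge : ∀ t → Diverge (s t)
      diverge zero    = d
      diverge (suc t) = next-diverge (walk t) (diverge t)

  perfect-matching-unique : ∀ u v → edge M′ u v ≡ edge M u v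
  perfect-matching-unique u v with edge M u v in uv | edge M′ u v in uv′
  ... | true  | true  = refl
  ... | false | false = refl
  ... | true  | false with () ← trans (sym uv′) (partner⇒edge M′ perfect′ (trans (partners-agree u) (partner-matched M uv)))
  ... | false | true  with () ← trans (sym uv) (partner⇒edge M perfect (trans (sym (partners-agree u)) (partner-matched M′ uv′)))

-- Unicyclic graphs

module CycleEdgeDeleted {n} {G : Graph n} (connected : Connected G) (C : Cycle G) (only-C : ∀ D → SameCycle C D)
         {x y : Fin n} (xy∈C : CycleEdge C x y) (y⇝x : Walk (deleteEdge G x y) y x) where

  private
    T : Graph n
    T = deleteEdge G x y

  open Walks T

  T-acyclic : ¬ Cycle T
  T-acyclic D = deleted-edge G x y (inj₁ (refl , refl))
    (cycleEdge-adj D (Equivalence.to (only-C (cycle-⊆ (deleteEdge-⊆ G x y) D) x y) xy∈C))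

  detour : ∀ {u v} → Walk G u v → Walk T u v
  detour here = here
  detour (step e w) with deleted-or-kept G x y e
  ... | inj₁ (inj₁ (refl , refl)) = reverseʷ y⇝x ++ʷ detour w
  ... | inj₁ (inj₂ (refl , refl)) = y⇝x ++ʷ detour w
  ... | inj₂ e′                   = step e′ (detour w)

  parity : Fin n → Bool
  parity u = odd (lengthʷ (detour (connected x u)))

  parity-adj : ∀ {u v} → Adj T u v → parity v ≡ not (parity u)
  parity-adj {u} {v} e = ¬-not λ pv≡pu → T-acyclic (odd-closed-walk⇒cycle closed (odd-closed pv≡pu))
    where
    to-u : Walk T x u
    to-u = detour (connected x u)
    to-v : Walk T x v
    to-v = detour (connected x v)
    closed : Walk T x x
    closed = to-u ++ʷ step e (reverseʷ to-v)
    odd-closed : parity v ≡ parity u → odd (lengthʷ closed) ≡ true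
    odd-closed pv≡pu = begin
      odd (lengthʷ closed)                              ≡⟨ cong odd (length-++ʷ to-u _) ⟩
      odd (lengthʷ to-u + suc (lengthʷ (reverseʷ to-v))) ≡⟨ cong (λ l → odd (lengthʷ to-u + suc l)) (length-reverseʷ to-v) ⟩
      odd (lengthʷ to-u + suc (lengthʷ to-v))           ≡⟨ odd-+ (lengthʷ to-u) (suc (lengthʷ to-v)) ⟩
      parity u xor not (parity v)                       ≡⟨ cong (λ b → parity u xor not b) pv≡pu ⟩
      parity u xor not (parity u)                       ≡⟨ not-distribʳ-xor (parity u) (parity u) ⟨
      not (parity u xor parity u)                       ≡⟨ cong not (xor-same (parity u)) ⟩
      true                                              ∎
      where open ≡-Reasoning

  side : Fin n → Bool
  side u = parity u xor parity x

  side-x : side x ≡ false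
  side-x = xor-same (parity x)

  side-adj : ∀ {u v} → Adj T u v → side v ≡ not (side u)
  side-adj {u} e = trans (cong (_xor parity x) (parity-adj e)) (sym (not-distribˡ-xor (parity u) (parity x)))

  module WithPerfectMatching (M : Matching G) (perfect : Perfect M) (xy∉M : edge M x y ≡ false) where

    side-partner : ∀ u → side (partner M u) ≡ not (side u)
    side-partner u = side-adj (avoiding⇒deleteEdge G x y M xy∉M (edge-partner M perfect u))

    2*count-side : 2 * count side ≡ n
    2*count-side = 2*count≡n (partner M) (partner-involutive M) side side-partner

    side-class : Subset n
    side-class = tabulate side

    ∈side-class : ∀ {u} → u ∈ side-class → side u ≡ true
    ∈side-class {u} u∈S = trans (sym (lookup∘tabulate side u)) ([]=⇒lookup u∈S)

    side-class-independent : Independent G side-class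
    side-class-independent u v u∈S v∈S e with deleted-or-kept G x y e
    ... | inj₁ (inj₁ (refl , refl)) = case trans (sym side-x) (∈side-class u∈S) of λ ()
    ... | inj₁ (inj₂ (refl , refl)) = case trans (sym side-x) (∈side-class v∈S) of λ ()
    ... | inj₂ e′                   = not-¬ refl (trans (∈side-class u∈S) (trans (sym (∈side-class v∈S)) (side-adj e′)))

    ∣side-class∣≡size : ∣ side-class ∣ ≡ size M
    ∣side-class∣≡size = *-cancelˡ-≡ _ _ 2 (begin
      2 * ∣ side-class ∣ ≡⟨ cong (2 *_) (trans (∣p∣≡count side-class) (sum-cong-≗ (cong indicator ∘ lookup∘tabulate side))) ⟩
      2 * count side     ≡⟨ 2*count-side ⟩
      n                  ≡⟨ 2*size≡n M perfect ⟨
      2 * size M         ∎)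
      where open ≡-Reasoning

    module _ (¬bipartite : ¬ Bipartite G) where

      side-y : side y ≡ false
      side-y with side y in sy
      ... | false = refl
      ... | true  = ⊥-elim (¬bipartite (side , proper))
        where
        proper : ∀ u v → Adj G u v → side u ≢ side v
        proper u v e with deleted-or-kept G x y e
        ... | inj₁ (inj₁ (refl , refl)) = λ sx≡sy → case trans (sym side-x) (trans sx≡sy sy) of λ ()
        ... | inj₁ (inj₂ (refl , refl)) = λ sy≡sx → case trans (sym side-x) (trans (sym sy≡sx) sy) of λ ()
        ... | inj₂ e′                   = λ su≡sv → not-¬ refl (trans su≡sv (side-adj e′))

      -- If xy ∈ M′, then M′ maps the side-class into its complement minus x, as x is matched to y.
      perfect-avoids-xy : ∀ (M′ : Matching G) → Perfect M′ → edge M′ x y ≡ false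
      perfect-avoids-xy M′ perfect′ with edge M′ x y in xy∈M′
      ... | false = refl
      ... | true  = ⊥-elim (<-irrefl 2*count-side
                      (2*count<n (partner M′) (partner-involutive M′) side leaves x side-x
                                 (trans (cong side (partner-matched M′ xy∈M′)) side-y)))
        where
        leaves : ∀ u → side u ≡ true → side (partner M′ u) ≡ false
        leaves u su with deleted-or-kept G x y (edge-adj M′ u (partner M′ u) (edge-partner M′ perfect′ u))
        ... | inj₁ (inj₁ (refl , _)) = case trans (sym side-x) su of λ ()
        ... | inj₁ (inj₂ (refl , _)) = case trans (sym side-y) su of λ ()
        ... | inj₂ e′                = trans (side-adj e′) (cong not su)

      unique : ∀ (M′ : Matching G) → Perfect M′ → ∀ u v → edge M′ u v ≡ edge M u v
      unique M′ perfect′ =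
        perfect-matching-unique T-acyclic (restrict G x y M xy∉M) (restrict G x y M′ (perfect-avoids-xy M′ perfect′)) perfect perfect′

module _ {n} {G : Graph n} {x y : Fin n} where

  path-avoiding-endpoint : ∀ z → z ≡ x ⊎ z ≡ y → ∀ u R → Path G (u ∷ R) → All (z ≢_) (u ∷ R) →
                           Walk (deleteEdge G x y) u (last u R)
  path-avoiding-endpoint z z∈xy u []      _       _               = here
  path-avoiding-endpoint z z∈xy u (r ∷ R) (e , p) (z≢u ∷ z≢r ∷ z∉R) =
    step (keep-edge G x y e not-xy) (path-avoiding-endpoint z z∈xy r R p (z≢r ∷ z∉R))
    where
    not-xy : ¬ IsEdge x y u r
    not-xy (inj₁ (refl , refl)) = Data.Sum.[ z≢u , z≢r ]′ z∈xy
    not-xy (inj₂ (refl , refl)) = Data.Sum.[ z≢r , z≢u ]′ z∈xy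

-- With ℓ the last vertex, take {ℓ, v₀} if it is not in M; otherwise {v₀, v₁} is not in M.
matching-misses-cycle-edge : ∀ {n} {G : Graph n} (C : Cycle G) (M : Matching G) →
  ∃₂ λ x y → CycleEdge C x y × edge M x y ≡ false × Walk (deleteEdge G x y) y x
matching-misses-cycle-edge record { rest = []     ; long = s≤s () }
matching-misses-cycle-edge record { rest = _ ∷ [] ; long = s≤s (s≤s ()) }
matching-misses-cycle-edge {G = G} record { start = v₀ ; rest = v₁ ∷ r ∷ R ; distinct = (v₀∉ ∷ (v₁∉ ∷ _))
                                         ; path = v₀v₁ , p ; closing = ℓv₀ } M
  with edge M (last r R) v₀ in ℓv₀∈M
... | false = last r R , v₀ , inj₂ (inj₂ (inj₁ (refl , refl))) , ℓv₀∈M ,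
              step (keep-edge G _ _ v₀v₁ not-ℓv₀) (path-avoiding-endpoint v₀ (inj₂ refl) v₁ (r ∷ R) p v₀∉)
  where
  not-ℓv₀ : ¬ IsEdge (last r R) v₀ v₀ v₁
  not-ℓv₀ (inj₁ (_ , v₁≡v₀)) = All.lookup v₀∉ (here refl) (sym v₁≡v₀)
  not-ℓv₀ (inj₂ (_ , v₁≡ℓ))  = All.lookup v₁∉ (last∈ r R) v₁≡ℓ
... | true  = v₀ , v₁ , inj₁ (inj₁ (refl , refl)) , v₀v₁∉M ,
              (path-avoiding-endpoint v₀ (inj₁ refl) v₁ (r ∷ R) p v₀∉ ++ʷ step (keep-edge G _ _ ℓv₀ not-v₀v₁) here)
  where
  open Walks (deleteEdge G v₀ v₁) using (_++ʷ_)
  v₁≢ℓ : v₁ ≢ last r R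
  v₁≢ℓ = All.lookup v₁∉ (last∈ r R)
  v₀v₁∉M : edge M v₀ v₁ ≡ false
  v₀v₁∉M with edge M v₀ v₁ in v₀v₁∈M
  ... | false = refl
  ... | true  = ⊥-elim (v₁≢ℓ (disjoint M v₀ v₁ (last r R) v₀v₁∈M (trans (edge-sym M v₀ (last r R)) ℓv₀∈M)))
  not-v₀v₁ : ¬ IsEdge v₀ v₁ (last r R) v₀
  not-v₀v₁ (inj₁ (ℓ≡v₀ , _)) = All.lookup v₀∉ (there (last∈ r R)) (sym ℓ≡v₀)
  not-v₀v₁ (inj₂ (ℓ≡v₁ , _)) = v₁≢ℓ (sym ℓ≡v₁)

proposition1 : ∀ {n} (G : Graph n) → Unicyclic G → ¬ Bipartite G
    → (M : Matching G) → Perfect M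
    → ((M′ : Matching G) → Perfect M′ → ∀ u v → edge M′ u v ≡ edge M u v)
      × KonigEgervary G
proposition1 G (connected , C , only-C) ¬bipartite M perfect
  with x , y , xy∈C , xy∉M , y⇝x ← matching-misses-cycle-edge C M =
  let open CycleEdgeDeleted connected C only-C xy∈C y⇝x
      open WithPerfectMatching M perfect xy∉M
  in  unique ¬bipartite
    , konigEgervary M perfect side-class side-class-independent ∣side-class∣≡size
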